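{- Let $n\ge1$, $k\ge0$ be integers, $T\in\mathrm{Inc}^k(2\times n)$ and $M=2n-k$. For $1\le i\le M+1$ let $x_i$ be the $(M+2-i)$th letter of the height word $S_{\mathcal{P}^{i-1}(T)}$. Then $S_{\mathcal{E}(T)}=x_{M+1}x_M\cdots x_1$.
   Context: Partitions are identified with Young diagrams in English convention; $|\lambda|$ is the number of boxes; $2\times n$ is the partition $(n,n)$. An increasing tableau of shape $\lambda$ is a filling of the boxes of $\lambda$ by positive integers, strictly increasing along rows and down columns, whose set of entries is $\{1,\dots,M\}$ for some $M$. $\mathrm{Inc}^k(\lambda)$ is the set of increasing tableaux of shape $\lambda$ with maximum entry $|\lambda|-k$. K-promotion: the SE-neighbors of a box are the (at most two) boxes of the shape immediately below it or immediately to its right. For an increasing tableau $T$ with maximum entry $M$, delete the entry $1$, leaving an empty box; then repeatedly, simultaneously on all empty boxes, until no empty box has an SE-neighbor: label each empty box by the minimal label among its SE-neighbors and remove that label from the SE-neighbor(s) in which it appears (an empty box with no SE-neighbor is left unchanged). Finally label all empty boxes by $M+1$ and subtract $1$ from every label; the result is $\mathcal{P}(T)$, again in $\mathrm{Inc}^k(2\times n)$. K-evacuation: $[T]_j$ is the Young diagram of boxes of $T$ with entry $\le j$; a chain $\emptyset=\mu_0\subseteq\cdots\subseteq\mu_M$ encodes the filling with $j$ in every box of $\mu_j\setminus\mu_{j-1}$. For $T$ with maximum entry $M$, $\mathcal{E}(T)$ is the increasing tableau encoded by $([\mathcal{P}^{M-j}(T)]_j)_{0\le j\le M}$. Height word: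 for $T\in\mathrm{Inc}^k(2\times n)$, each value $j\in\{1,\dots,M\}$ appears once or twice. Let $P_T$ be the lattice path from $(0,0)$ with $M$ steps, the $j$th step being $(1,1)$ if $j$ appears only in row 1, $(1,-1)$ if $j$ appears only in row 2, and $(2,0)$ if $j$ appears in both rows. The height word $S_T=s_1\cdots s_{M+1}$ lists the $y$-coordinates of the $M+1$ successive vertices of $P_T$; equivalently $s_i$ is the length of the first row minus the length of the second row of $[T]_{i-1}$. $T$ is determined by $S_T$. -}

module Defs where

open import Data.Nat using (ℕ; zero; suc; _+_; _*_; _∸_; _≤_; _<_; _⊔_; _≡ᵇ_; _≤ᵇ_)
open import Data.Fin using (Fin; zero; suc; toℕ)
open import Data.Fin.Properties using () renaming (_≟_ to _≟ᶠ_)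
open import Data.Maybe using (Maybe; just; nothing; maybe)
open import Data.List using (List; []; _∷_; [_]; _++_; map; concatMap; allFin; foldr; null; scanl; upTo)
open import Data.Bool.ListAction using (any)
open import Data.Bool using (Bool; true; false; if_then_else_; _∧_; _∨_; not)
open import Data.Product using (_×_; _,_; ∃)
open import Data.Integer using (ℤ; +_; -[1+_]) renaming (_+_ to _+ℤ_)
open import Relation.Nullary.Decidable using (⌊_⌋)
open import Relation.Binary.PropositionalEquality using (_≡_)

-- The shape 2×n : boxes (r , j) with r ∈ Fin 2 (row 0 = first row,
-- row 1 = second row) and j ∈ Fin n (column).

Pos : ℕ → Set
Pos n = Fin 2 × Fin n

Tab : ℕ → Set
Tab n = Pos n → ℕ

positions : ∀ n → List (Pos n)
positions n = concatMap (λ r → map (λ j → (r , j)) (allFin n)) (allFin 2)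

-- Increasing tableau of shape 2×n with maximum entry |λ| - k = 2n - k,
-- i.e. T ∈ Inc^k(2×n).
record IncK {n : ℕ} (k : ℕ) (T : Tab n) : Set where
  field
    rowStrict : ∀ (r : Fin 2) (j j' : Fin n) → toℕ j < toℕ j' → T (r , j) < T (r , j')
    colStrict : ∀ (j : Fin n) → T (zero , j) < T (suc zero , j)
    entryPos  : ∀ (p : Pos n) → 1 ≤ T p
    entryLe   : ∀ (p : Pos n) → T p ≤ 2 * n ∸ k
    entrySurj : ∀ (v : ℕ) → 1 ≤ v → v ≤ 2 * n ∸ k → ∃ λ (p : Pos n) → T p ≡ v

maxEntry : ∀ {n} → Tab n → ℕ
maxEntry {n} T = foldr (λ p acc → T p ⊔ acc) 0 (positions n)

nextFin : ∀ {n} → Fin n → Maybe (Fin n)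
nextFin {suc zero} zero = nothing
nextFin {suc (suc n)} zero = just (suc zero)
nextFin {suc (suc n)} (suc i) = maybe (λ i' → just (suc i')) nothing (nextFin {suc n} i)

seNbrs : ∀ {n} → Pos n → List (Pos n)
seNbrs (r , j) = right ++ below r
  where
  right = maybe (λ j' → [ (r , j') ]) [] (nextFin j)
  below : Fin 2 → List _
  below zero = [ (suc zero , j) ]
  below (suc _) = []

eqPos : ∀ {n} → Pos n → Pos n → Bool
eqPos (r , j) (r' , j') = ⌊ r ≟ᶠ r' ⌋ ∧ ⌊ j ≟ᶠ j' ⌋

elemPos : ∀ {n} → Pos n → List (Pos n) → Bool
elemPos p = any (eqPos p)

-- K-promotion.  Intermediate fillings: `nothing` = empty box.

Filling : ℕ → Set
Filling n = Pos n → Maybe ℕ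

minMaybe : Maybe ℕ → Maybe ℕ → Maybe ℕ
minMaybe nothing y = y
minMaybe (just x) nothing = just x
minMaybe (just x) (just y) = just (if x ≤ᵇ y then x else y)

minLabel : ∀ {n} → Filling n → Pos n → Maybe ℕ
minLabel f p = foldr (λ q acc → minMaybe (f q) acc) nothing (seNbrs p)

isEmpty : Maybe ℕ → Bool
isEmpty nothing = true
isEmpty (just _) = false

eqMaybe : Maybe ℕ → Maybe ℕ → Bool
eqMaybe nothing nothing = true
eqMaybe (just x) (just y) = x ≡ᵇ y
eqMaybe _ _ = false

active : ∀ {n} → Filling n → Pos n → Bool
active f q = isEmpty (f q) ∧ not (null (seNbrs q))

removed : ∀ {n} → Filling n → Pos n → ℕ → Bool
removed {n} f p v =
  any (λ q → active f q ∧ elemPos p (seNbrs q) ∧ eqMaybe (minLabel f q) (just v)) (positions n)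

slideStep : ∀ {n} → Filling n → Filling n
slideStep f p with f p
... | nothing = if null (seNbrs p) then nothing else minLabel f p
... | just v  = if removed f p v then nothing else just v

iter : {A : Set} → ℕ → (A → A) → A → A
iter zero g a = a
iter (suc m) g a = g (iter m g a)

-- "repeat until no empty box has an SE-neighbour": each step moves every
-- active empty box strictly south-east, so 2n steps suffice, and once the
-- process has terminated slideStep is the identity.
promotion : ∀ {n} → Tab n → Tab n
promotion {n} T p with iter (2 * n) slideStep f0 p
  where
  f0 : Filling n
  f0 q = if T q ≡ᵇ 1 then nothing else just (T q)
... | nothing = (maxEntry T + 1) ∸ 1
... | just v  = v ∸ 1

promotionPow : ∀ {n} → ℕ → Tab n → Tab n
promotionPow m = iter m promotion

-- K-evacuation: E(T) is encoded by the chain μ_j = [P^{M-j}(T)]_j,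
-- so the entry of box b is the least j with b ∈ μ_j.

evacuation : ∀ {n} → Tab n → Tab n
evacuation T b =
  foldr (λ j rest → if promotionPow (M ∸ j) T b ≤ᵇ j then j else rest) M (upTo (suc M))
  where
  M = maxEntry T

inRow : ∀ {n} → Tab n → Fin 2 → ℕ → Bool
inRow {n} T r v = any (λ c → T (r , c) ≡ᵇ v) (allFin n)

pathStep : ∀ {n} → Tab n → ℕ → ℤ
pathStep T v with inRow T zero v | inRow T (suc zero) v
... | true  | false = + 1
... | false | true  = -[1+ 0 ]
... | _     | _     = + 0

-- y-coordinates of the M+1 vertices of the lattice path P_T
heightWord : ∀ {n} → Tab n → List ℤ
heightWord T = scanl _+ℤ_ (+ 0) (map (λ j → pathStep T (suc j)) (upTo (maxEntry T)))

-- i-th letter (0-indexed) of a word, with a default for out-of-range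
nthOr : {A : Set} → A → List A → ℕ → A
nthOr d [] _ = d
nthOr d (x ∷ xs) zero = x
nthOr d (x ∷ xs) (suc i) = nthOr d xs i

module Submission where

-- After the entry 1 is deleted, sliding
--    moves a single hole along the anti-diagonals of 2×n into the last box.
--    An invariant of the sliding shows that P maps Inc^k(2×n) to itself,
--    puts M into the last box, lowers each entry by at most one, and keeps
--    each entry below the original entries further right in its row.
-- 2. Evacuation (module Evacuation).  Hence the shapes [Pᴹ⁻ʲ(T)]ⱼ form a
--    chain, so [E(T)]ⱼ = [Pᴹ⁻ʲ(T)]ⱼ; and E(T) has strictly increasing rows,
--    positive entries and maximum M.
-- 3. Heights.  For such fillings the j-th letter of the height word is the
--    first row length minus the second row length of [V]ⱼ, so it depends
--    only on [V]ⱼ.  Thus letter j of S_{E(T)} is letter j of S_{Pᴹ⁻ʲ(T)},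
--    i.e. x_{M−j+1}, which is the theorem.

open import Defs
open import Data.Nat using (ℕ; zero; suc; _+_; _*_; _∸_; _≤_; _<_; _⊔_; _≡ᵇ_; _≤ᵇ_; z≤n; s≤s; s≤s⁻¹; z<s; s<s; s<s⁻¹)
open import Data.Nat.Properties
open import Data.Fin using (Fin; zero; suc; toℕ; fromℕ; fromℕ<)
open import Data.Fin.Properties using (toℕ-injective; toℕ<n; toℕ-fromℕ; toℕ-fromℕ<) renaming (_≟_ to _≟ᶠ_)
open import Data.Maybe using (Maybe; just; nothing)
open import Data.Maybe.Properties using (just-injective)
open import Data.List using (List; []; _∷_; map; allFin; foldr; null; scanl; upTo; applyUpTo; applyDownFrom; reverse; tabulate)
open import Data.List.Properties using (map-applyUpTo; map-tabulate; reverse-applyUpTo)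
open import Data.List.Membership.Propositional using (_∈_; find; lose)
open import Data.List.Membership.Propositional.Properties using (∈-map⁺; ∈-++⁺ˡ; ∈-++⁺ʳ; ∈-allFin)
open import Data.List.Relation.Unary.Any using (here; there)
open import Data.List.Relation.Unary.Any.Properties using (any⁺; any⁻)
open import Data.Bool.ListAction using (any; or)
open import Data.Bool using (Bool; true; false; if_then_else_; _∧_; T)
open import Data.Bool.Properties using (T-≡; not-¬)
open import Data.Product using (_×_; _,_; ∃; proj₁; proj₂)
open import Data.Sum using (_⊎_; inj₁; inj₂)
open import Data.Empty using (⊥-elim)
open import Data.Integer using (ℤ; +_) renaming (_+_ to _+ℤ_; _-_ to _-ℤ_)
open import Data.Integer.Properties using (pos-+)
open import Data.Integer.Tactic.RingSolver using (solve-∀)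
open import Function.Bundles using (Equivalence)
open import Algebra.Properties.CommutativeSemigroup +-commutativeSemigroup using (interchange)
open import Relation.Nullary using (¬_; yes; no)
open import Relation.Binary.Definitions using (tri<; tri≈; tri>)
open import Relation.Binary.PropositionalEquality using (_≡_; _≢_; refl; sym; trans; cong; cong₂; subst; subst₂; module ≡-Reasoning)

-- Promotion, evacuation and the height word are defined by Boolean tests;
-- these lemmas translate `b ≡ true` / `b ≡ false` to and from the relations
-- decided (primed names are the `≡ true` forms of the library lemmas).

≡ᵇ⇒≡′ : ∀ {m n} → (m ≡ᵇ n) ≡ true → m ≡ n
≡ᵇ⇒≡′ {m} {n} e = ≡ᵇ⇒≡ m n (Equivalence.from T-≡ e)

≡⇒≡ᵇ′ : ∀ {m n} → m ≡ n → (m ≡ᵇ n) ≡ true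
≡⇒≡ᵇ′ {m} {n} e = Equivalence.to T-≡ (≡⇒≡ᵇ m n e)

≢⇒≢ᵇ : ∀ {m n} → m ≢ n → (m ≡ᵇ n) ≡ false
≢⇒≢ᵇ {m} {n} m≢n with m ≡ᵇ n in e
... | true  = ⊥-elim (m≢n (≡ᵇ⇒≡′ e))
... | false = refl

≤ᵇ⇒≤′ : ∀ {m n} → (m ≤ᵇ n) ≡ true → m ≤ n
≤ᵇ⇒≤′ {m} {n} e = ≤ᵇ⇒≤ m n (Equivalence.from T-≡ e)

≤⇒≤ᵇ′ : ∀ {m n} → m ≤ n → (m ≤ᵇ n) ≡ true
≤⇒≤ᵇ′ m≤n = Equivalence.to T-≡ (≤⇒≤ᵇ m≤n)

≰ᵇ⇒> : ∀ {m n} → (m ≤ᵇ n) ≡ false → n < m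
≰ᵇ⇒> {m} {n} e with m ≤? n
... | yes m≤n = ⊥-elim (subst T e (≤⇒≤ᵇ m≤n))
... | no  m≰n = ≰⇒> m≰n

>⇒≰ᵇ : ∀ {m n} → n < m → (m ≤ᵇ n) ≡ false
>⇒≰ᵇ {m} {n} n<m with m ≤ᵇ n in e
... | true  = ⊥-elim (<⇒≱ n<m (≤ᵇ⇒≤′ e))
... | false = refl

∧-true : ∀ a b → a ∧ b ≡ true → a ≡ true × b ≡ true
∧-true true true _ = refl , refl

isEmpty⇒nothing : ∀ {x} → isEmpty x ≡ true → x ≡ nothing
isEmpty⇒nothing {nothing} _ = refl

eqMaybe⇒≡ : ∀ x {v} → eqMaybe x (just v) ≡ true → x ≡ just v
eqMaybe⇒≡ (just x) e = cong just (≡ᵇ⇒≡′ e)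

nothing≢just : ∀ {A : Set} {x : A} → nothing ≢ just x
nothing≢just ()

maybe-cases : ∀ {A : Set} (x : Maybe A) → x ≡ nothing ⊎ ∃ λ v → x ≡ just v
maybe-cases nothing  = inj₁ refl
maybe-cases (just v) = inj₂ (v , refl)

any⇒∃ : ∀ {A : Set} (p : A → Bool) xs → any p xs ≡ true → ∃ λ x → x ∈ xs × p x ≡ true
any⇒∃ p xs e with find (any⁻ p xs (Equivalence.from T-≡ e))
... | x , x∈xs , px = x , x∈xs , Equivalence.to T-≡ px

∈⇒any : ∀ {A : Set} (p : A → Bool) {x} xs → x ∈ xs → p x ≡ true → any p xs ≡ true
∈⇒any p xs x∈xs px = Equivalence.to T-≡ (any⁺ p (lose x∈xs (Equivalence.from T-≡ px)))

null-∈ : ∀ {A : Set} (xs : List A) {x : A} → x ∈ xs → null xs ≡ false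
null-∈ (_ ∷ _) _ = refl

null-∉ : ∀ {A : Set} (xs : List A) → (∀ x → ¬ x ∈ xs) → null xs ≡ true
null-∉ []      _ = refl
null-∉ (x ∷ _) h = ⊥-elim (h x (here refl))

∈-positions : ∀ n (p : Pos n) → p ∈ positions n
∈-positions n (zero , j)     = ∈-++⁺ˡ (∈-map⁺ (zero ,_) (∈-allFin j))
∈-positions n (suc zero , j) = ∈-++⁺ʳ (map (zero ,_) (allFin n)) (∈-++⁺ˡ (∈-map⁺ (suc zero ,_) (∈-allFin j)))

eqPos⇒≡ : ∀ {n} (p q : Pos n) → eqPos p q ≡ true → p ≡ q
eqPos⇒≡ (r , j) (r′ , j′) e with r ≟ᶠ r′ | j ≟ᶠ j′
eqPos⇒≡ (r , j) (r′ , j′) e  | yes r≡r′ | yes j≡j′ = cong₂ _,_ r≡r′ j≡j′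
eqPos⇒≡ (r , j) (r′ , j′) () | yes _    | no _
eqPos⇒≡ (r , j) (r′ , j′) () | no _     | _

eqPos-refl : ∀ {n} (p : Pos n) → eqPos p p ≡ true
eqPos-refl (r , j) with r ≟ᶠ r | j ≟ᶠ j
... | yes _ | yes _  = refl
... | yes _ | no j≢j = ⊥-elim (j≢j refl)
... | no r≢r | _     = ⊥-elim (r≢r refl)

elemPos⇒∈ : ∀ {n} (p : Pos n) xs → elemPos p xs ≡ true → p ∈ xs
elemPos⇒∈ p xs e with any⇒∃ (eqPos p) xs e
... | q , q∈xs , p≈q rewrite eqPos⇒≡ p q p≈q = q∈xs

∈⇒elemPos : ∀ {n} (p : Pos n) xs → p ∈ xs → elemPos p xs ≡ true
∈⇒elemPos p xs p∈xs = ∈⇒any (eqPos p) xs p∈xs (eqPos-refl p)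

data Nbr {n : ℕ} : Pos n → Pos n → Set where
  right : ∀ r (c c′ : Fin n) → toℕ c′ ≡ suc (toℕ c) → Nbr (r , c) (r , c′)
  down  : ∀ (c : Fin n) → Nbr (zero , c) (suc zero , c)

nextFin⇒suc : ∀ {n} (c c′ : Fin n) → nextFin c ≡ just c′ → toℕ c′ ≡ suc (toℕ c)
nextFin⇒suc {suc (suc n)} zero .(suc zero) refl = refl
nextFin⇒suc {suc (suc n)} (suc c) c′ e with nextFin {suc n} c in eq
nextFin⇒suc {suc (suc n)} (suc c) .(suc c″) refl | just c″ = cong suc (nextFin⇒suc c c″ eq)

suc⇒nextFin : ∀ {n} (c c′ : Fin n) → toℕ c′ ≡ suc (toℕ c) → nextFin c ≡ just c′
suc⇒nextFin {suc (suc n)} zero (suc zero) e = refl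
suc⇒nextFin {suc (suc n)} (suc c) (suc c′) e rewrite suc⇒nextFin c c′ (suc-injective e) = refl

∈-seNbrs⇒Nbr : ∀ {n} (p q : Pos n) → q ∈ seNbrs p → Nbr p q
∈-seNbrs⇒Nbr (r , c) q q∈ with nextFin c in eq
∈-seNbrs⇒Nbr (r , c) q (here refl) | just c′ = right r c c′ (nextFin⇒suc c c′ eq)
∈-seNbrs⇒Nbr (zero , c) q (there (here refl)) | just c′ = down c
∈-seNbrs⇒Nbr (zero , c) q (here refl) | nothing = down c

Nbr⇒∈-seNbrs : ∀ {n} (p q : Pos n) → Nbr p q → q ∈ seNbrs p
Nbr⇒∈-seNbrs _ _ (right r c c′ e) rewrite suc⇒nextFin c c′ e = here refl
Nbr⇒∈-seNbrs _ _ (down c) with nextFin c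
... | just _  = there (here refl)
... | nothing = here refl

-- The least defined label of a filling over a list of boxes; `minLabel f p`
-- is `minOver f (seNbrs p)` by definition.  The `minMaybe` lemmas are the
-- two-element case.
minOver : ∀ {n} → Filling n → List (Pos n) → Maybe ℕ
minOver f = foldr (λ q acc → minMaybe (f q) acc) nothing

minMaybe-attained : ∀ a b {m} → minMaybe a b ≡ just m → a ≡ just m ⊎ b ≡ just m
minMaybe-attained nothing  b        e = inj₂ e
minMaybe-attained (just x) nothing  e = inj₁ e
minMaybe-attained (just x) (just y) e with x ≤ᵇ y
... | true  = inj₁ e
... | false = inj₂ e

minMaybe-≤ˡ : ∀ w b → ∃ λ m → minMaybe (just w) b ≡ just m × m ≤ w
minMaybe-≤ˡ w nothing = w , refl , ≤-refl
minMaybe-≤ˡ w (just y) with w ≤ᵇ y in e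
... | true  = w , refl , ≤-refl
... | false = y , refl , <⇒≤ (≰ᵇ⇒> e)

minMaybe-≤ʳ : ∀ a w → ∃ λ m → minMaybe a (just w) ≡ just m × m ≤ w
minMaybe-≤ʳ nothing  w = w , refl , ≤-refl
minMaybe-≤ʳ (just x) w with x ≤ᵇ w in e
... | true  = x , refl , ≤ᵇ⇒≤′ e
... | false = w , refl , ≤-refl

minOver-attained : ∀ {n} (f : Filling n) xs {m} → minOver f xs ≡ just m → ∃ λ q → q ∈ xs × f q ≡ just m
minOver-attained f (x ∷ xs) e with minMaybe-attained (f x) (minOver f xs) e
... | inj₁ fx   = x , here refl , fx
... | inj₂ rest with minOver-attained f xs rest
... | q , q∈xs , fq = q , there q∈xs , fq

minOver-≤ : ∀ {n} (f : Filling n) xs {q w} → q ∈ xs → f q ≡ just w → ∃ λ m → minOver f xs ≡ just m × m ≤ w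
minOver-≤ f (x ∷ xs) {w = w} (here refl) fq rewrite fq = minMaybe-≤ˡ w (minOver f xs)
minOver-≤ f (x ∷ xs) (there q∈xs) fq with minOver-≤ f xs q∈xs fq
... | m′ , e , m′≤w rewrite e with minMaybe-≤ʳ (f x) m′
... | m , e′ , m≤m′ = m , e′ , ≤-trans m≤m′ m′≤w

minOver-least : ∀ {n} (f : Filling n) xs {m q w} → minOver f xs ≡ just m → q ∈ xs → f q ≡ just w → m ≤ w
minOver-least f xs e q∈xs fq with minOver-≤ f xs q∈xs fq
... | m′ , e′ , m′≤w = subst (_≤ _) (just-injective (trans (sym e′) e)) m′≤w

slide-fills : ∀ {n} (f : Filling n) p q → f p ≡ nothing → Nbr p q → slideStep f p ≡ minLabel f p
slide-fills f p q fp p→q rewrite fp | null-∈ (seNbrs p) (Nbr⇒∈-seNbrs p q p→q) = refl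

slide-stays-empty : ∀ {n} (f : Filling n) p → f p ≡ nothing → (∀ q → ¬ Nbr p q) → slideStep f p ≡ nothing
slide-stays-empty f p fp last
  rewrite fp | null-∉ (seNbrs p) (λ q q∈ → last q (∈-seNbrs⇒Nbr p q q∈)) = refl

slide-keeps : ∀ {n} (f : Filling n) p {v} → f p ≡ just v → removed f p v ≡ false → slideStep f p ≡ just v
slide-keeps f p fp r rewrite fp | r = refl

slide-removes : ∀ {n} (f : Filling n) p {v} → f p ≡ just v → removed f p v ≡ true → slideStep f p ≡ nothing
slide-removes f p fp r rewrite fp | r = refl

slide-cases : ∀ {n} (f : Filling n) p {w} → slideStep f p ≡ just w →
  f p ≡ just w ⊎ (f p ≡ nothing × minLabel f p ≡ just w)
slide-cases f p e with f p
... | nothing with null (seNbrs p)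
...   | false = inj₂ (refl , e)
slide-cases f p e | just v with removed f p v
...   | false = inj₁ e

removed⇒ : ∀ {n} (f : Filling n) p v → removed f p v ≡ true →
  ∃ λ q → f q ≡ nothing × Nbr q p × minLabel f q ≡ just v
removed⇒ {n} f p v e with any⇒∃ _ (positions n) e
... | q , _ , test with ∧-true (active f q) _ test
... | q-active , rest with ∧-true (elemPos p (seNbrs q)) _ rest
... | p∈ , min≡v =
  q , isEmpty⇒nothing (proj₁ (∧-true (isEmpty (f q)) _ q-active)) ,
  ∈-seNbrs⇒Nbr q p (elemPos⇒∈ p (seNbrs q) p∈) , eqMaybe⇒≡ (minLabel f q) min≡v

⇒removed : ∀ {n} (f : Filling n) p v q → f q ≡ nothing → Nbr q p → minLabel f q ≡ just v → removed f p v ≡ true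
⇒removed {n} f p v q fq q→p ml = ∈⇒any _ (positions n) (∈-positions n q) test
  where
  q→p∈ : p ∈ seNbrs q
  q→p∈ = Nbr⇒∈-seNbrs q p q→p
  test : (active f q ∧ elemPos p (seNbrs q) ∧ eqMaybe (minLabel f q) (just v)) ≡ true
  test rewrite fq | null-∈ (seNbrs q) q→p∈ | ∈⇒elemPos p (seNbrs q) q→p∈ | ml = ≡⇒≡ᵇ′ {v} refl

depth : ∀ {n} → Pos n → ℕ
depth (r , c) = toℕ r + toℕ c

Nbr-depth : ∀ {n} {p q : Pos n} → Nbr p q → depth q ≡ suc (depth p)
Nbr-depth (right r c c′ e) rewrite e = +-suc (toℕ r) (toℕ c)
Nbr-depth (down c) = refl

depth-≤ : ∀ {n} (p : Pos n) → depth p ≤ n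
depth-≤ (zero , c)     = <⇒≤ (toℕ<n c)
depth-≤ (suc zero , c) = toℕ<n c

lastBox : ∀ {n′} → Pos (suc n′)
lastBox {n′} = (suc zero , fromℕ n′)

depth≡n⇒lastBox : ∀ {n′} (p : Pos (suc n′)) → depth p ≡ suc n′ → p ≡ lastBox
depth≡n⇒lastBox (zero , c) e = ⊥-elim (<⇒≢ (toℕ<n c) e)
depth≡n⇒lastBox {n′} (suc zero , c) e =
  cong (suc zero ,_) (toℕ-injective (trans (suc-injective e) (sym (toℕ-fromℕ n′))))

lastBox-no-Nbr : ∀ {n′} (q : Pos (suc n′)) → ¬ Nbr lastBox q
lastBox-no-Nbr {n′} q last→q = 1+n≰n (subst (_≤ suc n′) depth-q (depth-≤ q))
  where
  depth-q : depth q ≡ suc (suc n′)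
  depth-q = trans (Nbr-depth last→q) (cong (λ d → suc (suc d)) (toℕ-fromℕ n′))

shallow-has-Nbr : ∀ {n} (p : Pos n) → depth p < n → ∃ λ q → Nbr p q
shallow-has-Nbr (zero , c)     _  = (suc zero , c) , down c
shallow-has-Nbr (suc zero , c) lt = (suc zero , fromℕ< lt) , right (suc zero) c (fromℕ< lt) (toℕ-fromℕ< lt)

maxEntry-≡ : ∀ {n} (V : Tab n) M → (∀ p → V p ≤ M) → (∃ λ p → V p ≡ M) → maxEntry V ≡ M
maxEntry-≡ {n} V M bounded (p , Vp≡M) =
  ≤-antisym (fold-≤ (positions n)) (subst (_≤ maxEntry V) Vp≡M (≤-fold (positions n) (∈-positions n p)))
  where
  fold : List (Pos n) → ℕ
  fold = foldr (λ q acc → V q ⊔ acc) 0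
  fold-≤ : ∀ xs → fold xs ≤ M
  fold-≤ []       = z≤n
  fold-≤ (x ∷ xs) = ⊔-lub (bounded x) (fold-≤ xs)
  ≤-fold : ∀ xs {q} → q ∈ xs → V q ≤ fold xs
  ≤-fold (x ∷ xs) (here refl)  = m≤m⊔n (V x) _
  ≤-fold (x ∷ xs) (there q∈xs) = ≤-trans (≤-fold xs q∈xs) (m≤n⊔m (V x) _)

RowsStrict : ∀ {n} → Tab n → Set
RowsStrict {n} V = ∀ (r : Fin 2) (c c′ : Fin n) → toℕ c < toℕ c′ → V (r , c) < V (r , c′)

Nbr-increasing⇒RowsStrict : ∀ {n} (V : Tab n) → (∀ p q → Nbr p q → V p < V q) → RowsStrict V
Nbr-increasing⇒RowsStrict {n} V incr r c c′ c<c′ = go (toℕ c′ ∸ suc (toℕ c)) c′ gap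
  where
  gap : toℕ c′ ≡ suc (toℕ c′ ∸ suc (toℕ c) + toℕ c)
  gap = sym (trans (sym (+-suc (toℕ c′ ∸ suc (toℕ c)) (toℕ c))) (m∸n+n≡m c<c′))
  go : ∀ d (c′ : Fin n) → toℕ c′ ≡ suc (d + toℕ c) → V (r , c) < V (r , c′)
  go zero    c′ e = incr _ _ (right r c c′ e)
  go (suc d) c′ e = <-trans (go d c″ (toℕ-fromℕ< lt)) (incr _ _ (right r c″ c′ (trans e (cong suc (sym (toℕ-fromℕ< lt))))))
    where
    lt : suc (d + toℕ c) < n
    lt = <-trans (subst (suc (d + toℕ c) <_) (sym e) ≤-refl) (toℕ<n c′)
    c″ : Fin n
    c″ = fromℕ< lt

module Increasing {n′ k : ℕ} {U : Tab (suc n′)} (U-inc : IncK k U) where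
  open IncK U-inc

  Nbr-< : ∀ {p q} → Nbr p q → U p < U q
  Nbr-< (right r c c′ e) = rowStrict r c c′ (≤-reflexive (sym e))
  Nbr-< (down c)         = colStrict c

  corner : Pos (suc n′)
  corner = (zero , zero)

  corner-< : ∀ p → 0 < depth p → U corner < U p
  corner-< (zero , zero)   ()
  corner-< (zero , suc c)   _ = rowStrict zero zero (suc c) z<s
  corner-< (suc zero , c)   _ = ≤-<-trans (corner-≤-row c) (colStrict c)
    where
    corner-≤-row : ∀ c → U corner ≤ U (zero , c)
    corner-≤-row zero    = ≤-refl
    corner-≤-row (suc c) = <⇒≤ (rowStrict zero zero (suc c) z<s)

  corner-≤ : ∀ p → U corner ≤ U p
  corner-≤ (zero , zero)  = ≤-refl
  corner-≤ (zero , suc c) = <⇒≤ (corner-< (zero , suc c) z<s)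
  corner-≤ (suc zero , c) = <⇒≤ (corner-< (suc zero , c) z<s)

  1≤M : 1 ≤ 2 * suc n′ ∸ k
  1≤M = ≤-trans (entryPos corner) (entryLe corner)

  corner≡1 : U corner ≡ 1
  corner≡1 with entrySurj 1 ≤-refl 1≤M
  ... | p , Up≡1 = ≤-antisym (subst (U corner ≤_) Up≡1 (corner-≤ p)) (entryPos corner)

  maxEntry≡M : maxEntry U ≡ 2 * suc n′ ∸ k
  maxEntry≡M = maxEntry-≡ U _ entryLe (entrySurj _ 1≤M ≤-refl)

-- After the entry 1 is deleted from the
-- corner, the sliding moves a single hole one anti-diagonal south-east per
-- step: after t steps the only empty box has depth t, every deeper box
-- still holds its original label, and the labels present are exactly
-- 2 … M, increasing along SE-steps.  After n steps the hole sits in the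
-- last box, which has no SE-neighbour, and sliding stops changing anything.
module Promotion {n′ k : ℕ} {U : Tab (suc n′)} (U-inc : IncK k U) where
  open IncK U-inc
  open Increasing U-inc

  n M : ℕ
  n = suc n′
  M = 2 * n ∸ k

  record Sliding (t : ℕ) (f : Filling n) : Set where
    field
      ahead       : ∀ p → t < depth p → f p ≡ just (U p)
      empty-front : ∀ p → f p ≡ nothing → depth p ≡ t
      hole        : ∃ λ p → depth p ≡ t × f p ≡ nothing
      bounds      : ∀ p {w} → f p ≡ just w → U p ≤ w × 2 ≤ w × w ≤ M
      below-next  : ∀ p q {w} → Nbr p q → f p ≡ just w → w ≤ U q
      increasing  : ∀ p q {w w′} → Nbr p q → f p ≡ just w → f q ≡ just w′ → w < w′
      complete    : ∀ w → 2 ≤ w → w ≤ M → ∃ λ p → f p ≡ just w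

  module Step {t : ℕ} {f : Filling n} (t<n : t < n) (I : Sliding t f) where
    open Sliding I

    kept : ∀ p {v} → f p ≡ just v → depth p ≢ suc t → slideStep f p ≡ just v
    kept p {v} fp off with removed f p v in r
    ... | false = slide-keeps f p fp r
    ... | true with removed⇒ f p v r
    ... | q , fq , q→p , _ = ⊥-elim (off (trans (Nbr-depth q→p) (cong suc (empty-front q fq))))

    hole-Nbr : ∀ p q → f p ≡ nothing → Nbr p q → f q ≡ just (U q)
    hole-Nbr p q fp p→q = ahead q (≤-reflexive (sym (trans (Nbr-depth p→q) (cong suc (empty-front p fp)))))

    filled : ∀ p → f p ≡ nothing → ∃ λ m → minLabel f p ≡ just m × slideStep f p ≡ just m
    filled p fp with shallow-has-Nbr p (subst (_< n) (sym (empty-front p fp)) t<n)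
    ... | q , p→q with minOver-≤ f (seNbrs p) (Nbr⇒∈-seNbrs p q p→q) (hole-Nbr p q fp p→q)
    ... | m , ml , _ = m , ml , trans (slide-fills f p q fp p→q) ml

    ahead′ : ∀ p → suc t < depth p → slideStep f p ≡ just (U p)
    ahead′ p lt = kept p (ahead p (<-trans (n<1+n t) lt)) (λ e → <⇒≢ lt (sym e))

    empty-front′ : ∀ p → slideStep f p ≡ nothing → depth p ≡ suc t
    empty-front′ p gp with maybe-cases (f p)
    ... | inj₁ fp = ⊥-elim (nothing≢just (trans (sym gp) (proj₂ (proj₂ (filled p fp)))))
    ... | inj₂ (v , fp) with removed f p v in r
    ...   | false = ⊥-elim (nothing≢just (trans (sym gp) (slide-keeps f p fp r)))
    ...   | true with removed⇒ f p v r
    ...   | q , fq , q→p , _ = trans (Nbr-depth q→p) (cong suc (empty-front q fq))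

    -- The neighbour whose label slid into the hole is the new hole.
    hole′ : ∃ λ p → depth p ≡ suc t × slideStep f p ≡ nothing
    hole′ with hole
    ... | q , dq , fq with filled q fq
    ... | m , ml , _ with minOver-attained f (seNbrs q) ml
    ... | p , p∈ , fp with ∈-seNbrs⇒Nbr q p p∈
    ... | q→p = p , trans (Nbr-depth q→p) (cong suc dq) , slide-removes f p fp (⇒removed f p m q fq q→p ml)

    bounds′ : ∀ p {w} → slideStep f p ≡ just w → U p ≤ w × 2 ≤ w × w ≤ M
    bounds′ p gp with slide-cases f p gp
    ... | inj₁ fp = bounds p fp
    ... | inj₂ (_ , ml) with minOver-attained f (seNbrs p) ml
    ... | q , q∈ , fq with bounds q fq
    ... | Uq≤w , 2≤w , w≤M = ≤-trans (<⇒≤ (Nbr-< (∈-seNbrs⇒Nbr p q q∈))) Uq≤w , 2≤w , w≤M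

    below-next′ : ∀ p q {w} → Nbr p q → slideStep f p ≡ just w → w ≤ U q
    below-next′ p q p→q gp with slide-cases f p gp
    ... | inj₁ fp        = below-next p q p→q fp
    ... | inj₂ (fp , ml) = minOver-least f (seNbrs p) ml (Nbr⇒∈-seNbrs p q p→q) (hole-Nbr p q fp p→q)

    -- The label sliding into the hole p is smaller than whatever stays in
    -- its neighbour q: it is at most U q, and equal to U q only if it was
    -- taken from q.
    slid-< : ∀ p q {w w′} → Nbr p q → f p ≡ nothing → minLabel f p ≡ just w → slideStep f q ≡ just w′ → w < w′
    slid-< p q {w} p→q fp ml gq with slide-cases f q gq
    ... | inj₂ (fq , _) = ⊥-elim (nothing≢just (trans (sym fq) (hole-Nbr p q fp p→q)))
    ... | inj₁ fq with just-injective (trans (sym fq) (hole-Nbr p q fp p→q))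
    ... | refl = ≤∧≢⇒< (minOver-least f (seNbrs p) ml (Nbr⇒∈-seNbrs p q p→q) fq) taken
      where
      taken : w ≢ U q
      taken refl = nothing≢just (trans (sym (slide-removes f q fq (⇒removed f q w p fp p→q ml))) gq)

    increasing′ : ∀ p q {w w′} → Nbr p q → slideStep f p ≡ just w → slideStep f q ≡ just w′ → w < w′
    increasing′ p q p→q gp gq with slide-cases f p gp | slide-cases f q gq
    ... | inj₂ (fp , ml) | _              = slid-< p q p→q fp ml gq
    ... | inj₁ fp        | inj₁ fq        = increasing p q p→q fp fq
    ... | inj₁ fp        | inj₂ (fq , ml) with minOver-attained f (seNbrs q) ml
    ... | q′ , q′∈ , fq′ =
      <-≤-trans (≤-<-trans (below-next p q p→q fp) (Nbr-< (∈-seNbrs⇒Nbr q q′ q′∈))) (proj₁ (bounds q′ fq′))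

    -- A label is either kept or taken by the hole.
    complete′ : ∀ w → 2 ≤ w → w ≤ M → ∃ λ p → slideStep f p ≡ just w
    complete′ w 2≤w w≤M with complete w 2≤w w≤M
    ... | p , fp with removed f p w in r
    ... | false = p , slide-keeps f p fp r
    ... | true with removed⇒ f p w r
    ... | q , fq , q→p , ml = q , trans (slide-fills f q p fq q→p) ml

    step : Sliding (suc t) (slideStep f)
    step = record
      { ahead = ahead′ ; empty-front = empty-front′ ; hole = hole′ ; bounds = bounds′
      ; below-next = below-next′ ; increasing = increasing′ ; complete = complete′ }

  start : Filling n
  start q = if U q ≡ᵇ 1 then nothing else just (U q)

  start-≢1 : ∀ p → U p ≢ 1 → start p ≡ just (U p)
  start-≢1 p Up≢1 rewrite ≢⇒≢ᵇ Up≢1 = refl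

  start-just : ∀ p {w} → start p ≡ just w → U p ≡ w × U p ≢ 1
  start-just p e with U p ≡ᵇ 1 in is1
  ... | false = just-injective e , λ Up≡1 → not-¬ (≡⇒≡ᵇ′ Up≡1) is1

  deep-≢1 : ∀ p → 0 < depth p → U p ≢ 1
  deep-≢1 p 0<d Up≡1 = <⇒≢ (corner-< p 0<d) (trans corner≡1 (sym Up≡1))

  start-empty-front : ∀ p → start p ≡ nothing → depth p ≡ 0
  start-empty-front p e = n≤0⇒n≡0 (≮⇒≥ (λ 0<d → nothing≢just (trans (sym e) (start-≢1 p (deep-≢1 p 0<d)))))

  start-hole : start corner ≡ nothing
  start-hole rewrite corner≡1 = refl

  start-bounds : ∀ p {w} → start p ≡ just w → U p ≤ w × 2 ≤ w × w ≤ M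
  start-bounds p e with start-just p e
  ... | refl , Up≢1 = ≤-refl , ≤∧≢⇒< (entryPos p) (λ 1≡Up → Up≢1 (sym 1≡Up)) , entryLe p

  start-below-next : ∀ p q {w} → Nbr p q → start p ≡ just w → w ≤ U q
  start-below-next p q p→q e with start-just p e
  ... | refl , _ = <⇒≤ (Nbr-< p→q)

  start-increasing : ∀ p q {w w′} → Nbr p q → start p ≡ just w → start q ≡ just w′ → w < w′
  start-increasing p q p→q e e′ with start-just p e | start-just q e′
  ... | refl , _ | refl , _ = Nbr-< p→q

  start-complete : ∀ w → 2 ≤ w → w ≤ M → ∃ λ p → start p ≡ just w
  start-complete w 2≤w w≤M with entrySurj w (<⇒≤ 2≤w) w≤M
  ... | p , Up≡w = p , trans (start-≢1 p (λ Up≡1 → <⇒≢ 2≤w (trans (sym Up≡1) Up≡w))) (cong just Up≡w)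

  sliding-start : Sliding 0 start
  sliding-start = record
    { ahead = λ p 0<d → start-≢1 p (deep-≢1 p 0<d) ; empty-front = start-empty-front
    ; hole = corner , refl , start-hole ; bounds = start-bounds ; below-next = start-below-next
    ; increasing = start-increasing ; complete = start-complete }

  Sliding-≗ : ∀ {t f g} → (∀ p → g p ≡ f p) → Sliding t f → Sliding t g
  Sliding-≗ g≗f I = record
    { ahead       = λ p lt → trans (g≗f p) (ahead p lt)
    ; empty-front = λ p e → empty-front p (trans (sym (g≗f p)) e)
    ; hole        = let (p , d , e) = hole in p , d , trans (g≗f p) e
    ; bounds      = λ p e → bounds p (trans (sym (g≗f p)) e)
    ; below-next  = λ p q p→q e → below-next p q p→q (trans (sym (g≗f p)) e)
    ; increasing  = λ p q p→q e e′ → increasing p q p→q (trans (sym (g≗f p)) e) (trans (sym (g≗f q)) e′)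
    ; complete    = λ w 2≤w w≤M → let (p , e) = complete w 2≤w w≤M in p , trans (g≗f p) e
    }
    where open Sliding I

  hole-is-last : ∀ {f} → Sliding n f → ∀ p → f p ≡ nothing → p ≡ lastBox
  hole-is-last I p fp = depth≡n⇒lastBox p (Sliding.empty-front I p fp)

  settled : ∀ {f} → Sliding n f → ∀ p → slideStep f p ≡ f p
  settled {f} I p with maybe-cases (f p)
  ... | inj₁ fp = trans (slide-stays-empty f p fp no-Nbr) (sym fp)
    where
    no-Nbr : ∀ q → ¬ Nbr p q
    no-Nbr q p→q = lastBox-no-Nbr q (subst (λ x → Nbr x q) (hole-is-last I p fp) p→q)
  ... | inj₂ (v , fp) with removed f p v in r
  ...   | false = trans (slide-keeps f p fp r) (sym fp)
  ...   | true with removed⇒ f p v r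
  ...   | q , fq , q→p , _ = ⊥-elim (lastBox-no-Nbr p (subst (λ x → Nbr x p) (hole-is-last I q fq) q→p))

  sliding : ∀ t → t ≤ n → Sliding t (iter t slideStep start)
  sliding zero    _   = sliding-start
  sliding (suc t) t<n = Step.step t<n (sliding t (<⇒≤ t<n))

  sliding-settled : ∀ j → Sliding n (iter (j + n) slideStep start)
  sliding-settled zero    = sliding n ≤-refl
  sliding-settled (suc j) = Sliding-≗ (settled (sliding-settled j)) (sliding-settled j)

  final : Filling n
  final = iter (2 * n) slideStep start

  sliding-final : Sliding n final
  sliding-final = subst (λ m → Sliding n (iter m slideStep start)) (cong (λ m → n + m) (sym (+-identityʳ n))) (sliding-settled n)

  open Sliding sliding-final

  finish : Maybe ℕ → ℕ
  finish nothing  = maxEntry U + 1 ∸ 1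
  finish (just v) = v ∸ 1

  promotion-≡ : ∀ p → promotion U p ≡ finish (final p)
  promotion-≡ p with final p
  ... | nothing = refl
  ... | just _  = refl

  promotion-hole : ∀ p → final p ≡ nothing → promotion U p ≡ M
  promotion-hole p e = trans (promotion-≡ p) (trans (cong finish e) (trans (m+n∸n≡m (maxEntry U) 1) maxEntry≡M))

  promotion-label : ∀ p {v} → final p ≡ just v → promotion U p ≡ v ∸ 1
  promotion-label p e = trans (promotion-≡ p) (cong finish e)

  final-last : final lastBox ≡ nothing
  final-last with hole
  ... | p , d , fp = subst (λ q → final q ≡ nothing) (depth≡n⇒lastBox p d) fp

  Nbr-labelled : ∀ p q → Nbr p q → ∃ λ v → final p ≡ just v
  Nbr-labelled p q p→q with maybe-cases (final p)
  ... | inj₁ fp       = ⊥-elim (lastBox-no-Nbr q (subst (λ x → Nbr x q) (hole-is-last sliding-final p fp) p→q))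
  ... | inj₂ labelled = labelled

  -- Labels are at least 2, so lowering them by one keeps them positive.
  label-pos : ∀ p {v} → final p ≡ just v → 1 ≤ v
  label-pos p fp = <⇒≤ (proj₁ (proj₂ (bounds p fp)))

  promotion-last : promotion U lastBox ≡ M
  promotion-last = promotion-hole lastBox final-last

  promotion-<-next : ∀ p q → Nbr p q → promotion U p < U q
  promotion-<-next p q p→q with Nbr-labelled p q p→q
  ... | v , fp = subst (_< U q) (sym (promotion-label p fp)) (∸-monoˡ-< (s≤s (below-next p q p→q fp)) (label-pos p fp))

  promotion-≥ : ∀ p → U p ≤ promotion U p + 1
  promotion-≥ p with maybe-cases (final p)
  ... | inj₁ fp       = subst (λ x → U p ≤ x + 1) (sym (promotion-hole p fp)) (≤-trans (entryLe p) (m≤m+n M 1))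
  ... | inj₂ (v , fp) = subst (λ x → U p ≤ x + 1) (sym (promotion-label p fp))
                          (subst (U p ≤_) (sym (m∸n+n≡m (label-pos p fp))) (proj₁ (bounds p fp)))

  promotion-increasing : ∀ p q → Nbr p q → promotion U p < promotion U q
  promotion-increasing p q p→q with Nbr-labelled p q p→q | maybe-cases (final q)
  ... | v , fp | inj₁ fq       = subst₂ _<_ (sym (promotion-label p fp)) (sym (promotion-hole q fq))
                                   (∸-monoˡ-< (s≤s (proj₂ (proj₂ (bounds p fp)))) (label-pos p fp))
  ... | v , fp | inj₂ (w , fq) = subst₂ _<_ (sym (promotion-label p fp)) (sym (promotion-label q fq))
                                   (∸-monoˡ-< (increasing p q p→q fp fq) (label-pos p fp))

  promotion-entries : ∀ p → 1 ≤ promotion U p × promotion U p ≤ M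
  promotion-entries p with maybe-cases (final p)
  ... | inj₁ fp       = subst (λ x → 1 ≤ x × x ≤ M) (sym (promotion-hole p fp)) (1≤M , ≤-refl)
  ... | inj₂ (v , fp) = subst (λ x → 1 ≤ x × x ≤ M) (sym (promotion-label p fp))
                          (∸-monoˡ-≤ 1 (proj₁ (proj₂ (bounds p fp))) , ≤-trans (m∸n≤m v 1) (proj₂ (proj₂ (bounds p fp))))

  promotion-onto : ∀ v → 1 ≤ v → v ≤ M → ∃ λ p → promotion U p ≡ v
  promotion-onto v 1≤v v≤M with m≤n⇒m<n∨m≡n v≤M
  ... | inj₂ v≡M = lastBox , trans promotion-last (sym v≡M)
  ... | inj₁ v<M with complete (suc v) (s≤s 1≤v) v<M
  ... | p , fp = p , promotion-label p fp

  promotion-inc : IncK k (promotion U)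
  promotion-inc = record
    { rowStrict = Nbr-increasing⇒RowsStrict (promotion U) promotion-increasing
    ; colStrict = λ c → promotion-increasing _ _ (down c)
    ; entryPos  = λ p → proj₁ (promotion-entries p)
    ; entryLe   = λ p → proj₂ (promotion-entries p)
    ; entrySurj = promotion-onto
    }

  promotion-<-right : ∀ r (c c′ : Fin n) → toℕ c < toℕ c′ → promotion U (r , c) < U (r , c′)
  promotion-<-right r c c′ c<c′ = <-≤-trans (promotion-<-next (r , c) (r , c₁) (right r c c₁ (toℕ-fromℕ< c+1<n))) c₁≤c′
    where
    c+1<n : suc (toℕ c) < n
    c+1<n = ≤-<-trans c<c′ (toℕ<n c′)
    c₁ : Fin n
    c₁ = fromℕ< c+1<n
    c₁≤c′ : U (r , c₁) ≤ U (r , c′)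
    c₁≤c′ with m≤n⇒m<n∨m≡n (subst (_≤ toℕ c′) (sym (toℕ-fromℕ< c+1<n)) c<c′)
    ... | inj₁ c₁<c′ = <⇒≤ (rowStrict r c₁ c′ c₁<c′)
    ... | inj₂ c₁≡c′ = ≤-reflexive (cong (λ x → U (r , x)) (toℕ-injective c₁≡c′))

scanl-applyUpTo : ∀ {A B : Set} (_∙_ : A → B → A) (h : ℕ → A) (s : ℕ → B) →
  (∀ i → h (suc i) ≡ h i ∙ s i) → ∀ L → scanl _∙_ (h 0) (applyUpTo s L) ≡ applyUpTo h (suc L)
scanl-applyUpTo _∙_ h s h-step zero    = refl
scanl-applyUpTo _∙_ h s h-step (suc L) = cong (h 0 ∷_)
  (trans (cong (λ x → scanl _∙_ x (applyUpTo (λ i → s (suc i)) L)) (sym (h-step 0)))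
         (scanl-applyUpTo _∙_ (λ i → h (suc i)) (λ i → s (suc i)) (λ i → h-step (suc i)) L))

height : ∀ {n} → Tab n → ℕ → ℤ
height V zero    = + 0
height V (suc j) = height V j +ℤ pathStep V (suc j)

heightWord-≡ : ∀ {n} (V : Tab n) → heightWord V ≡ applyUpTo (height V) (suc (maxEntry V))
heightWord-≡ V =
  trans (cong (scanl _+ℤ_ (+ 0)) (map-applyUpTo (λ j → j) (λ j → pathStep V (suc j)) (maxEntry V)))
        (scanl-applyUpTo _+ℤ_ (height V) (λ j → pathStep V (suc j)) (λ _ → refl) (maxEntry V))

ι : Bool → ℕ
ι b = if b then 1 else 0

countFin : ∀ m → (Fin m → Bool) → ℕ
countFin zero    _    = 0
countFin (suc m) test = ι (test zero) + countFin m (λ c → test (suc c))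

countFin-cong : ∀ m {p q : Fin m → Bool} → (∀ c → p c ≡ q c) → countFin m p ≡ countFin m q
countFin-cong zero    _   = refl
countFin-cong (suc m) p≗q = cong₂ _+_ (cong ι (p≗q zero)) (countFin-cong m (λ c → p≗q (suc c)))

countFin-none : ∀ m (p : Fin m → Bool) → (∀ c → p c ≡ false) → countFin m p ≡ 0
countFin-none zero    p none = refl
countFin-none (suc m) p none rewrite none zero = countFin-none m (λ c → p (suc c)) (λ c → none (suc c))

countFin-split : ∀ m (p q r : Fin m → Bool) → (∀ c → ι (p c) ≡ ι (q c) + ι (r c)) →
  countFin m p ≡ countFin m q + countFin m r
countFin-split zero    p q r split = refl
countFin-split (suc m) p q r split = begin
  ι (p zero) + countFin m (λ c → p (suc c))
    ≡⟨ cong₂ _+_ (split zero) (countFin-split m _ _ _ (λ c → split (suc c))) ⟩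
  (ι (q zero) + ι (r zero)) + (countFin m (λ c → q (suc c)) + countFin m (λ c → r (suc c)))
    ≡⟨ interchange (ι (q zero)) (ι (r zero)) _ _ ⟩
  (ι (q zero) + countFin m (λ c → q (suc c))) + (ι (r zero) + countFin m (λ c → r (suc c)))
    ∎
  where open ≡-Reasoning

ι-≤ᵇ-suc : ∀ x j → ι (x ≤ᵇ suc j) ≡ ι (x ≤ᵇ j) + ι (x ≡ᵇ suc j)
ι-≤ᵇ-suc x j with <-cmp x (suc j)
... | tri< x<1+j _ _
  rewrite ≤⇒≤ᵇ′ (<⇒≤ x<1+j) | ≤⇒≤ᵇ′ (s≤s⁻¹ x<1+j) | ≢⇒≢ᵇ (<⇒≢ x<1+j) = refl
... | tri≈ _ refl _
  rewrite ≤⇒≤ᵇ′ (≤-refl {suc j}) | >⇒≰ᵇ (n<1+n j) | ≡⇒≡ᵇ′ {suc j} refl = refl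
... | tri> _ _ 1+j<x
  rewrite >⇒≰ᵇ 1+j<x | >⇒≰ᵇ (<-trans (n<1+n j) 1+j<x) | ≢⇒≢ᵇ (λ x≡1+j → <⇒≢ 1+j<x (sym x≡1+j)) = refl

-- A strictly increasing sequence takes each value at most once, so counting
-- its occurrences is testing for one.
countFin-≡ᵇ : ∀ m (g : Fin m → ℕ) → (∀ (c c′ : Fin m) → toℕ c < toℕ c′ → g c < g c′) → ∀ v →
  countFin m (λ c → g c ≡ᵇ v) ≡ ι (any (λ c → g c ≡ᵇ v) (allFin m))
countFin-≡ᵇ zero    g strict v = refl
countFin-≡ᵇ (suc m) g strict v with g zero ≡ᵇ v in g0≡v
... | true  = cong suc (countFin-none m _ (λ c → ≢⇒≢ᵇ (λ gc≡v → <⇒≢ (strict zero (suc c) z<s) (trans (≡ᵇ⇒≡′ g0≡v) (sym gc≡v)))))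
... | false = trans (countFin-≡ᵇ m (λ c → g (suc c)) (λ c c′ lt → strict (suc c) (suc c′) (s<s lt)) v)
                    (cong ι (any-tabulate-suc (λ c → g c ≡ᵇ v)))
  where
  any-tabulate-suc : (p : Fin (suc m) → Bool) → any (λ c → p (suc c)) (allFin m) ≡ any p (tabulate suc)
  any-tabulate-suc p = cong or (trans (map-tabulate (λ c → c) (λ c → p (suc c))) (sym (map-tabulate suc p)))

-- The number of entries ≤ j in row r, i.e. the length of row r of [V]ⱼ.
rowCount : ∀ {n} → Tab n → Fin 2 → ℕ → ℕ
rowCount {n} V r j = countFin n (λ c → V (r , c) ≤ᵇ j)

rowCount-suc : ∀ {n} (V : Tab n) → RowsStrict V → ∀ r j →
  rowCount V r (suc j) ≡ rowCount V r j + ι (inRow V r (suc j))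
rowCount-suc {n} V strict r j =
  trans (countFin-split n _ _ _ (λ c → ι-≤ᵇ-suc (V (r , c)) j))
        (cong (λ x → rowCount V r j + x) (countFin-≡ᵇ n (λ c → V (r , c)) (strict r) (suc j)))

pathStep-ι : ∀ {n} (V : Tab n) v → pathStep V v ≡ + ι (inRow V zero v) -ℤ + ι (inRow V (suc zero) v)
pathStep-ι V v with inRow V zero v | inRow V (suc zero) v
... | true  | true  = refl
... | true  | false = refl
... | false | true  = refl
... | false | false = refl

height-rowCount : ∀ {n} (V : Tab n) → RowsStrict V → (∀ p → 1 ≤ V p) →
  ∀ j → height V j ≡ + rowCount V zero j -ℤ + rowCount V (suc zero) j
height-rowCount {n} V strict pos zero
  rewrite countFin-none n _ (λ c → >⇒≰ᵇ (pos (zero , c)))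
        | countFin-none n _ (λ c → >⇒≰ᵇ (pos (suc zero , c))) = refl
height-rowCount {n} V strict pos (suc j) = begin
  height V j +ℤ pathStep V (suc j)
    ≡⟨ cong₂ _+ℤ_ (height-rowCount V strict pos j) (pathStep-ι V (suc j)) ⟩
  (+ a -ℤ + b) +ℤ (+ ι₁ -ℤ + ι₂)
    ≡⟨ regroup (+ a) (+ b) (+ ι₁) (+ ι₂) ⟩
  (+ a +ℤ + ι₁) -ℤ (+ b +ℤ + ι₂)
    ≡⟨ cong₂ _-ℤ_ (sym (pos-+ a ι₁)) (sym (pos-+ b ι₂)) ⟩
  + (a + ι₁) -ℤ + (b + ι₂)
    ≡⟨ cong₂ (λ x y → + x -ℤ + y) (sym (rowCount-suc V strict zero j)) (sym (rowCount-suc V strict (suc zero) j)) ⟩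
  + rowCount V zero (suc j) -ℤ + rowCount V (suc zero) (suc j)
    ∎
  where
  open ≡-Reasoning
  a b ι₁ ι₂ : ℕ
  a  = rowCount V zero j
  b  = rowCount V (suc zero) j
  ι₁ = ι (inRow V zero (suc j))
  ι₂ = ι (inRow V (suc zero) (suc j))
  regroup : ∀ (w x y z : ℤ) → (w -ℤ x) +ℤ (y -ℤ z) ≡ (w +ℤ y) -ℤ (x +ℤ z)
  regroup = solve-∀

height-shape : ∀ {n} (V W : Tab n) → RowsStrict V → RowsStrict W → (∀ p → 1 ≤ V p) → (∀ p → 1 ≤ W p) →
  ∀ j → (∀ p → (V p ≤ᵇ j) ≡ (W p ≤ᵇ j)) → height V j ≡ height W j
height-shape {n} V W V-strict W-strict V-pos W-pos j same-shape = begin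
  height V j                                   ≡⟨ height-rowCount V V-strict V-pos j ⟩
  + rowCount V zero j -ℤ + rowCount V (suc zero) j ≡⟨ cong₂ (λ x y → + x -ℤ + y) (same-row zero) (same-row (suc zero)) ⟩
  + rowCount W zero j -ℤ + rowCount W (suc zero) j ≡⟨ sym (height-rowCount W W-strict W-pos j) ⟩
  height W j                                   ∎
  where
  open ≡-Reasoning
  same-row : ∀ r → rowCount V r j ≡ rowCount W r j
  same-row r = countFin-cong n (λ c → same-shape (r , c))

nthOr-applyUpTo : ∀ {A : Set} (d : A) (h : ℕ → A) L j → j < L → nthOr d (applyUpTo h L) j ≡ h j
nthOr-applyUpTo d h (suc L) zero    _   = refl
nthOr-applyUpTo d h (suc L) (suc j) j<L = nthOr-applyUpTo d (λ i → h (suc i)) L j (s<s⁻¹ j<L)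

nthOr-heightWord : ∀ {n} (V : Tab n) j → j ≤ maxEntry V → nthOr (+ 0) (heightWord V) j ≡ height V j
nthOr-heightWord V j j≤max =
  trans (cong (λ w → nthOr (+ 0) w j) (heightWord-≡ V)) (nthOr-applyUpTo (+ 0) (height V) _ j (s≤s j≤max))

m∸n≡1+[m∸1+n] : ∀ m n → n < m → m ∸ n ≡ suc (m ∸ suc n)
m∸n≡1+[m∸1+n] (suc m) zero    _   = refl
m∸n≡1+[m∸1+n] (suc m) (suc n) n<m = m∸n≡1+[m∸1+n] m n (s<s⁻¹ n<m)

-- The first element of a list passing a test, or a default; evacuation
-- reads off each entry this way.
firstOr : (ℕ → Bool) → ℕ → List ℕ → ℕ
firstOr test d = foldr (λ j rest → if test j then j else rest) d

firstOr-passes : ∀ (test : ℕ → Bool) d xs → test d ≡ true → test (firstOr test d xs) ≡ true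
firstOr-passes test d []       d-ok = d-ok
firstOr-passes test d (x ∷ xs) d-ok with test x in x-ok
... | true  = x-ok
... | false = firstOr-passes test d xs d-ok

firstOr-≤ : ∀ (test : ℕ → Bool) d (f : ℕ → ℕ) → (∀ {i i′} → i ≤ i′ → f i ≤ f i′) →
  ∀ L i → i < L → test (f i) ≡ true → firstOr test d (applyUpTo f L) ≤ f i
firstOr-≤ test d f mono (suc L) i i<L fi-ok with test (f 0) in f0-ok
... | true = mono z≤n
firstOr-≤ test d f mono (suc L) zero    i<L fi-ok | false = ⊥-elim (not-¬ fi-ok f0-ok)
firstOr-≤ test d f mono (suc L) (suc i) i<L fi-ok | false =
  firstOr-≤ test d (λ x → f (suc x)) (λ i≤i′ → mono (s≤s i≤i′)) L i (s<s⁻¹ i<L) fi-ok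

-- Writing Pᵐ for the m-th promotion,
-- box b lies in the j-th shape of the chain defining E(T) iff
-- Pᴹ⁻ʲ(T)(b) ≤ j.  These shapes grow with j, so E(T)(b) ≤ j holds
-- exactly when b lies in the j-th shape: [E(T)]ⱼ = [Pᴹ⁻ʲ(T)]ⱼ.
module Evacuation {n′ k : ℕ} {T : Tab (suc n′)} (T-inc : IncK k T) where
  n M : ℕ
  n = suc n′
  M = 2 * n ∸ k

  P : ℕ → Tab n
  P m = promotionPow m T

  P-inc : ∀ m → IncK k (P m)
  P-inc zero    = T-inc
  P-inc (suc m) = Promotion.promotion-inc (P-inc m)

  maxEntry-P : ∀ m → maxEntry (P m) ≡ M
  maxEntry-P m = Increasing.maxEntry≡M (P-inc m)

  InChain : Pos n → ℕ → Set
  InChain b j = P (M ∸ j) b ≤ j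

  -- The shapes form a chain, because one promotion lowers an entry by at most one.
  InChain-suc : ∀ b {j} → j < M → InChain b j → InChain b (suc j)
  InChain-suc b {j} j<M b∈ =
    subst (P (M ∸ suc j) b ≤_) (+-comm j 1)
      (≤-trans (Promotion.promotion-≥ (P-inc (M ∸ suc j)) b)
               (+-monoˡ-≤ 1 (subst (λ m → P m b ≤ j) (m∸n≡1+[m∸1+n] M j j<M) b∈)))

  InChain-mono : ∀ b {i j} → i ≤ j → j ≤ M → InChain b i → InChain b j
  InChain-mono b {i} {zero}  i≤j _ b∈ = subst (InChain b) (n≤0⇒n≡0 i≤j) b∈
  InChain-mono b {i} {suc j} i≤j j<M b∈ with m≤n⇒m<n∨m≡n i≤j
  ... | inj₂ i≡j = subst (InChain b) i≡j b∈
  ... | inj₁ i<j = InChain-suc b j<M (InChain-mono b (s≤s⁻¹ i<j) (<⇒≤ j<M) b∈)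

  InChain-M : ∀ b → InChain b M
  InChain-M b = subst (λ m → P m b ≤ M) (sym (n∸n≡0 M)) (IncK.entryLe T-inc b)

  inChain? : Pos n → ℕ → Bool
  inChain? b j = P (M ∸ j) b ≤ᵇ j

  evacuation-≡ : ∀ b → evacuation T b ≡ firstOr (inChain? b) M (upTo (suc M))
  evacuation-≡ b = cong (λ X → firstOr (λ j → promotionPow (X ∸ j) T b ≤ᵇ j) X (upTo (suc X))) (maxEntry-P 0)

  E : Tab n
  E = evacuation T

  E-InChain : ∀ b → InChain b (E b)
  E-InChain b = subst (InChain b) (sym (evacuation-≡ b))
    (≤ᵇ⇒≤′ (firstOr-passes (inChain? b) M (upTo (suc M)) (≤⇒≤ᵇ′ (InChain-M b))))

  E-least : ∀ b {j} → j ≤ M → InChain b j → E b ≤ j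
  E-least b {j} j≤M b∈ = subst (_≤ j) (sym (evacuation-≡ b))
    (firstOr-≤ (inChain? b) M (λ x → x) (λ i≤i′ → i≤i′) (suc M) j (s≤s j≤M) (≤⇒≤ᵇ′ b∈))

  E-≤M : ∀ b → E b ≤ M
  E-≤M b = E-least b ≤-refl (InChain-M b)

  evacuation-shape : ∀ b {j} → j ≤ M → (E b ≤ᵇ j) ≡ inChain? b j
  evacuation-shape b {j} j≤M with inChain? b j in b∈?
  ... | true = ≤⇒≤ᵇ′ (E-least b j≤M (≤ᵇ⇒≤′ b∈?))
  ... | false = >⇒≰ᵇ (≰⇒> λ Eb≤j → <⇒≱ (≰ᵇ⇒> b∈?) (InChain-mono b Eb≤j j≤M (E-InChain b)))

  E-pos : ∀ b → 1 ≤ E b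
  E-pos b = ≤-trans (IncK.entryPos (P-inc (M ∸ E b)) b) (E-InChain b)

  -- Every promotion puts M into the last box, so it joins only the last shape.
  E-last : E lastBox ≡ M
  E-last with m≤n⇒m<n∨m≡n (E-≤M lastBox)
  ... | inj₂ E≡M = E≡M
  ... | inj₁ E<M = ⊥-elim (<⇒≱ E<M (subst (_≤ E lastBox) promoted-last (E-InChain lastBox)))
    where
    promoted-last : P (M ∸ E lastBox) lastBox ≡ M
    promoted-last = trans (cong (λ m → P m lastBox) (m∸n≡1+[m∸1+n] M _ E<M))
                          (Promotion.promotion-last (P-inc (M ∸ suc (E lastBox))))

  maxEntry-E : maxEntry E ≡ M
  maxEntry-E = maxEntry-≡ E M E-≤M (lastBox , E-last)

  InChain-left : ∀ r (c c′ : Fin n) → toℕ c < toℕ c′ → ∀ {e} → e < M → InChain (r , c′) (suc e) → InChain (r , c) e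
  InChain-left r c c′ c<c′ {e} e<M c′∈ =
    subst (λ m → P m (r , c) ≤ e) (sym (m∸n≡1+[m∸1+n] M e e<M))
      (s≤s⁻¹ (<-≤-trans (Promotion.promotion-<-right (P-inc (M ∸ suc e)) r c c′ c<c′) c′∈))

  E-RowsStrict : RowsStrict E
  E-RowsStrict r c c′ c<c′ = below (E (r , c′)) refl
    where
    below : ∀ e → E (r , c′) ≡ e → E (r , c) < e
    below zero    E≡0 = ⊥-elim (<⇒≱ (subst (1 ≤_) E≡0 (E-pos (r , c′))) z≤n)
    below (suc e) E≡1+e = s≤s (E-least (r , c) (<⇒≤ e<M)
                            (InChain-left r c c′ c<c′ e<M (subst (InChain (r , c′)) E≡1+e (E-InChain (r , c′)))))
      where
      e<M : e < M
      e<M = subst (_≤ M) E≡1+e (E-≤M (r , c′))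

  evacuation-letter : ∀ j → j ≤ M → height E j ≡ nthOr (+ 0) (heightWord (P (M ∸ j))) j
  evacuation-letter j j≤M =
    trans (height-shape E (P (M ∸ j)) E-RowsStrict (IncK.rowStrict (P-inc (M ∸ j))) E-pos (IncK.entryPos (P-inc (M ∸ j)))
                        j (λ b → evacuation-shape b j≤M))
          (sym (nthOr-heightWord (P (M ∸ j)) j (subst (j ≤_) (sym (maxEntry-P (M ∸ j))) j≤M)))

applyUpTo-cong : ∀ {A : Set} L {f g : ℕ → A} → (∀ i → i < L → f i ≡ g i) → applyUpTo f L ≡ applyUpTo g L
applyUpTo-cong zero    f≗g = refl
applyUpTo-cong (suc L) f≗g = cong₂ _∷_ (f≗g 0 z<s) (applyUpTo-cong L (λ i i<L → f≗g (suc i) (s<s i<L)))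

applyDownFrom-applyUpTo : ∀ {A : Set} (f : ℕ → A) L → applyDownFrom f L ≡ applyUpTo (λ j → f (L ∸ suc j)) L
applyDownFrom-applyUpTo f zero    = refl
applyDownFrom-applyUpTo f (suc L) = cong (f L ∷_) (applyDownFrom-applyUpTo f L)

reverse-applyUpTo-∸ : ∀ {A : Set} (f : ℕ → A) M → reverse (applyUpTo f (suc M)) ≡ applyUpTo (λ j → f (M ∸ j)) (suc M)
reverse-applyUpTo-∸ f M = trans (reverse-applyUpTo f (suc M)) (applyDownFrom-applyUpTo f (suc M))

-- Position j of S_{E(T)}
-- holds the letter at j of S_{Pᴹ⁻ʲ(T)}, which is x_{M-j+1}.
lemma3p8 : (n k : ℕ) → 1 ≤ n → (T : Tab n) → IncK k T →
    heightWord (evacuation T)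
      ≡ reverse (applyUpTo (λ i → nthOr (+ 0) (heightWord (promotionPow i T)) ((2 * n ∸ k) ∸ i)) (suc (2 * n ∸ k)))
lemma3p8 (suc n′) k _ T T-inc = begin
  heightWord E                               ≡⟨ heightWord-≡ E ⟩
  applyUpTo (height E) (suc (maxEntry E))    ≡⟨ cong (λ m → applyUpTo (height E) (suc m)) maxEntry-E ⟩
  applyUpTo (height E) (suc M)               ≡⟨ applyUpTo-cong (suc M) letter ⟩
  applyUpTo (λ j → x (M ∸ j)) (suc M)        ≡⟨ sym (reverse-applyUpTo-∸ x M) ⟩
  reverse (applyUpTo x (suc M))              ∎
  where
  open ≡-Reasoning
  open Evacuation T-inc
  x : ℕ → ℤ
  x i = nthOr (+ 0) (heightWord (P i)) (M ∸ i)
  letter : ∀ j → j < suc M → height E j ≡ x (M ∸ j)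
  letter j j<1+M = trans (evacuation-letter j (s≤s⁻¹ j<1+M))
                         (cong (nthOr (+ 0) (heightWord (P (M ∸ j)))) (sym (m∸[m∸n]≡n (s≤s⁻¹ j<1+M))))
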